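{- For each pair of positive integers $n$ and $k$, the graph $H(k,n) \times K_{n+1}$ is well-covered.
   Context: Graphs are finite and simple. For positive integers $k,n$, the graph $H(k,n)$ (of order $k(n+1)$) is obtained from the disjoint union of a complete graph $K_{kn}$ and an independent set $\{z_1,\ldots,z_k\}$ by partitioning $V(K_{kn})$ into sets $A_1,\ldots,A_k$ each of size $n$ and adding edges so that the open neighborhood of $z_i$ is exactly $A_i$ for each $i$. The direct product $G\times H$ has vertex set $V(G)\times V(H)$, with $(g_1,h_1)(g_2,h_2)$ an edge iff $g_1g_2\in E(G)$ and $h_1h_2\in E(H)$. A graph is well-covered if all of its maximal independent sets have the same cardinality. -}

module Defs where

open import Data.Nat using (ℕ; suc; _*_)
open import Data.Fin using (Fin; zero; suc; remQuot)
open import Data.Fin.Subset using (Subset; _∈_; _⊆_; ∣_∣)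
open import Data.Product using (_×_; _,_; proj₁; proj₂)
open import Data.Sum using (_⊎_)
open import Relation.Binary.PropositionalEquality using (_≡_; _≢_; refl) renaming (sym to ≡sym)
open import Relation.Nullary using (¬_)
open import Data.Empty using (⊥)
open import Data.Unit using (⊤)

record Graph : Set₁ where
  field
    order  : ℕ
    Adj    : Fin order → Fin order → Set
    sym    : ∀ {u v} → Adj u v → Adj v u
    irrefl : ∀ {v} → ¬ Adj v v
open Graph public

Independent : (G : Graph) → Subset (order G) → Set
Independent G S = ∀ u v → u ∈ S → v ∈ S → ¬ Adj G u v

MaximalIndependent : (G : Graph) → Subset (order G) → Set
MaximalIndependent G S =
  Independent G S × (∀ T → Independent G T → S ⊆ T → T ⊆ S)

WellCovered : Graph → Set
WellCovered G = ∀ S T → MaximalIndependent G S → MaximalIndependent G T → ∣ S ∣ ≡ ∣ T ∣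

K : ℕ → Graph
K m = record
  { order = m
  ; Adj = λ u v → u ≢ v
  ; sym = λ p q → p (≡sym q)
  ; irrefl = λ p → p refl
  }

-- Direct (tensor) product; vertex (g , h) of G × H is encoded as
-- combine g h : Fin (order G * order H), decoded by remQuot.
_×ᵍ_ : Graph → Graph → Graph
G ×ᵍ H = record
  { order = order G * order H
  ; Adj = λ x y → Adj G (proj₁ (dec x)) (proj₁ (dec y)) × Adj H (proj₂ (dec x)) (proj₂ (dec y))
  ; sym = λ { (a , b) → sym G a , sym H b }
  ; irrefl = λ { (a , _) → irrefl G a }
  }
  where
    dec : Fin (order G * order H) → Fin (order G) × Fin (order H)
    dec = remQuot {order G} (order H)

-- H(k,n): vertices are pairs (i , j) with i : Fin k, j : Fin (suc n),
-- encoded via combine/remQuot.  (i , zero) is z_i; (i , suc a), a : Fin n,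
-- are the n vertices of A_i.  The vertices (i , suc a) form the clique K_{kn},
-- and z_i is adjacent exactly to the vertices of A_i.
HAdj : ∀ {k n} → (Fin k × Fin (suc n)) → (Fin k × Fin (suc n)) → Set
HAdj (i , zero)  (i' , zero)   = ⊥
HAdj (i , zero)  (i' , suc a') = i ≡ i'
HAdj (i , suc a) (i' , zero)   = i ≡ i'
HAdj (i , suc a) (i' , suc a') = (i , a) ≢ (i' , a')

private
  HAdj-sym : ∀ {k n} (x y : Fin k × Fin (suc n)) → HAdj x y → HAdj y x
  HAdj-sym (i , zero)  (i' , zero)   ()
  HAdj-sym (i , zero)  (i' , suc a') p = ≡sym p
  HAdj-sym (i , suc a) (i' , zero)   p = ≡sym p
  HAdj-sym (i , suc a) (i' , suc a') p q = p (≡sym q)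

  HAdj-irrefl : ∀ {k n} (x : Fin k × Fin (suc n)) → ¬ HAdj x x
  HAdj-irrefl (i , zero)  ()
  HAdj-irrefl (i , suc a) p = p refl

hdec : ∀ k n → Fin (k * suc n) → Fin k × Fin (suc n)
hdec k n = remQuot {k} (suc n)

H : ℕ → ℕ → Graph
H k n = record
  { order = k * suc n
  ; Adj = λ x y → HAdj (hdec k n x) (hdec k n y)
  ; sym = λ {x} {y} → HAdj-sym (hdec k n x) (hdec k n y)
  ; irrefl = λ {x} → HAdj-irrefl (hdec k n x)
  }

{-# OPTIONS --safe #-}
-- A subset S of G × K m is described by its fibres Φ v = { c ∣ (v , c) ∈ S }.
-- Independence says that any colour on v equals any colour on a neighbour w
-- of v; maximality says that c ∈ Φ v as soon as every colour on every
-- neighbour of v is c. In H(k,n) × K(n+1) each block {z_i} ∪ A_i then carries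
-- exactly n + 1 pairs: if no vertex of A_i is coloured, z_i carries all n + 1
-- colours; if some x ∈ A_i carries two colours, all neighbours of x (among
-- them the rest of the block) are uncoloured, so x carries all colours;
-- otherwise x carries a single colour c, and every vertex of the block has
-- fibre exactly {c}. Hence every maximal independent set has k (n + 1) elements.

module Submission where

open import Defs
open import Data.Bool using (if_then_else_)
open import Data.Empty using (⊥-elim)
open import Data.Fin using (Fin; zero; suc; combine; remQuot; punchIn; _↑ˡ_; _↑ʳ_; _≟_)
open import Data.Fin.Properties using (remQuot-combine; combine-remQuot; punchInᵢ≢i; any?)
open import Data.Fin.Subset using (Subset; _∈_; ∣_∣; ⁅_⁆; _∪_; Empty; inside; outside)
open import Data.Fin.Subset.Properties
  using (_∈?_; nonempty?; Empty-unique; ∣⊥∣≡0; ∣⊤∣≡n; ∣⁅x⁆∣≡1; ⊆⊤; ⊆-antisym;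
         x∈⁅x⁆; x∈⁅y⁆⇒x≡y; q⊆p∪q; x∈p∪q⁻; x∈p∪q⁺)
open import Data.Nat using (ℕ; zero; suc; _+_; _*_; _≥_)
open import Data.Nat.Properties using (+-0-commutativeMonoid; +-assoc; +-identityʳ; *-identityʳ)
open import Data.Product using (_×_; _,_; proj₁; proj₂; ∃; uncurry)
open import Data.Product.Properties using (≡-dec)
open import Data.Sum using (inj₁; inj₂)
open import Data.Vec using ([]; _∷_; lookup; tabulate)
open import Data.Vec.Properties using (lookup∘tabulate; []=⇒lookup; lookup⇒[]=)
open import Function using (_∘_; id; _⇔_; mk⇔; Equivalence)
open import Relation.Binary.PropositionalEquality as ≡ using (_≡_; _≢_; refl; trans; cong; subst; subst₂)
open import Relation.Nullary using (¬_; yes; no; ¬?)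
open import Relation.Nullary.Decidable using (_×-dec_)
open import Algebra.Properties.CommutativeMonoid.Sum +-0-commutativeMonoid
  using (sum; sum-syntax; sum-cong-≗; sum-remove; sum-replicate-zero)

open ≡.≡-Reasoning

∑-↑ : ∀ m {n} (f : Fin (m + n) → ℕ) →
      sum f ≡ ∑[ i < m ] f (i ↑ˡ n) + ∑[ j < n ] f (m ↑ʳ j)
∑-↑ zero    f = refl
∑-↑ (suc m) f = trans (cong (f zero +_) (∑-↑ m (f ∘ suc))) (≡.sym (+-assoc (f zero) _ _))

∑-combine : ∀ m {n} (f : Fin (m * n) → ℕ) →
            sum f ≡ ∑[ i < m ] ∑[ j < n ] f (combine i j)
∑-combine zero        f = refl
∑-combine (suc m) {n} f =
  trans (∑-↑ n f) (cong (∑[ j < n ] f (j ↑ˡ m * n) +_) (∑-combine m (f ∘ (n ↑ʳ_))))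

∑-const : ∀ m x → ∑[ i < m ] x ≡ m * x
∑-const zero    x = refl
∑-const (suc m) x = cong (x +_) (∑-const m x)

∑-single : ∀ {m} (f : Fin m → ℕ) i → (∀ j → j ≢ i → f j ≡ 0) → sum f ≡ f i
∑-single {suc m} f i off = begin
  sum f                           ≡⟨ sum-remove f ⟩
  f i + sum (f ∘ punchIn i)       ≡⟨ cong (f i +_) (sum-cong-≗ (λ j → off _ (punchInᵢ≢i i j))) ⟩
  f i + ∑[ j < m ] 0              ≡⟨ cong (f i +_) (sum-replicate-zero m) ⟩
  f i + 0                         ≡⟨ +-identityʳ (f i) ⟩
  f i                             ∎

indicator : ∀ {n} → Subset n → Fin n → ℕ
indicator p x = if lookup p x then 1 else 0

∣p∣≡∑indicator : ∀ {n} (p : Subset n) → ∣ p ∣ ≡ sum (indicator p)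
∣p∣≡∑indicator []            = refl
∣p∣≡∑indicator (inside  ∷ p) = cong suc (∣p∣≡∑indicator p)
∣p∣≡∑indicator (outside ∷ p) = ∣p∣≡∑indicator p

∣p∣≡0 : ∀ {n} {p : Subset n} → Empty p → ∣ p ∣ ≡ 0
∣p∣≡0 {n} p-empty = trans (cong ∣_∣ (Empty-unique p-empty)) (∣⊥∣≡0 n)

∣p∣≡n : ∀ {n} {p : Subset n} → (∀ x → x ∈ p) → ∣ p ∣ ≡ n
∣p∣≡n {n} p-full = trans (cong ∣_∣ (⊆-antisym ⊆⊤ (λ {x} _ → p-full x))) (∣⊤∣≡n n)

∣p∣≡1 : ∀ {n} {p : Subset n} {x} → x ∈ p → (∀ {y} → y ∈ p → y ≡ x) → ∣ p ∣ ≡ 1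
∣p∣≡1 {p = p} {x} x∈p unique = trans (cong ∣_∣ p≡⁅x⁆) (∣⁅x⁆∣≡1 x)
  where
  p≡⁅x⁆ : p ≡ ⁅ x ⁆
  p≡⁅x⁆ = ⊆-antisym (λ y∈p → subst (_∈ ⁅ x ⁆) (≡.sym (unique y∈p)) (x∈⁅x⁆ x))
                    (λ {y} y∈⁅x⁆ → subst (_∈ p) (≡.sym (x∈⁅y⁆⇒x≡y x y∈⁅x⁆)) x∈p)

∑∣∣-one-full : ∀ {N m} (p : Fin N → Subset m) j₀ →
              (∀ x → x ∈ p j₀) → (∀ j → j ≢ j₀ → Empty (p j)) → ∑[ j < N ] ∣ p j ∣ ≡ m
∑∣∣-one-full p j₀ full others-empty =
  trans (∑-single (∣_∣ ∘ p) j₀ (λ j j≢j₀ → ∣p∣≡0 (others-empty j j≢j₀))) (∣p∣≡n full)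

∑∣∣-singletons : ∀ {N m} (p : Fin N → Subset m) x →
                 (∀ j → x ∈ p j) → (∀ j {y} → y ∈ p j → y ≡ x) → ∑[ j < N ] ∣ p j ∣ ≡ N
∑∣∣-singletons {N} p x x∈ unique = begin
  ∑[ j < N ] ∣ p j ∣  ≡⟨ sum-cong-≗ (λ j → ∣p∣≡1 (x∈ j) (unique j)) ⟩
  ∑[ j < N ] 1        ≡⟨ ∑-const N 1 ⟩
  N * 1               ≡⟨ *-identityʳ N ⟩
  N                   ∎

maximal-absorbs : ∀ G {S} → MaximalIndependent G S →
                  ∀ {v} → (∀ {w} → w ∈ S → ¬ Adj G v w) → v ∈ S
maximal-absorbs G {S} (independent , maximal) {v} free =
  maximal (⁅ v ⁆ ∪ S) extended (q⊆p∪q ⁅ v ⁆ S) (x∈p∪q⁺ (inj₁ (x∈⁅x⁆ v)))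
  where
  extended : Independent G (⁅ v ⁆ ∪ S)
  extended u w u∈ w∈ with x∈p∪q⁻ ⁅ v ⁆ S u∈ | x∈p∪q⁻ ⁅ v ⁆ S w∈
  ... | inj₁ u∈⁅v⁆ | inj₁ w∈⁅v⁆ rewrite x∈⁅y⁆⇒x≡y v u∈⁅v⁆ | x∈⁅y⁆⇒x≡y v w∈⁅v⁆ = irrefl G
  ... | inj₁ u∈⁅v⁆ | inj₂ w∈S    rewrite x∈⁅y⁆⇒x≡y v u∈⁅v⁆ = free w∈S
  ... | inj₂ u∈S    | inj₁ w∈⁅v⁆ rewrite x∈⁅y⁆⇒x≡y v w∈⁅v⁆ = free u∈S ∘ sym G
  ... | inj₂ u∈S    | inj₂ w∈S    = independent u w u∈S w∈S

fibre : ∀ {a m} → Subset (a * m) → Fin a → Subset m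
fibre S g = tabulate (λ c → lookup S (combine g c))

∈-fibre⁻ : ∀ {a m} {S : Subset (a * m)} {g c} → c ∈ fibre S g → combine g c ∈ S
∈-fibre⁻ {a} {m} {S} {g} {c} c∈ =
  lookup⇒[]= (combine g c) S
    (trans (≡.sym (lookup∘tabulate (lookup S ∘ combine {a} {m} g) c)) ([]=⇒lookup c∈))

∈-fibre⁺ : ∀ {a m} {S : Subset (a * m)} {g c} → combine g c ∈ S → c ∈ fibre S g
∈-fibre⁺ {a} {m} {S} {g} {c} gc∈ =
  lookup⇒[]= c (fibre S g)
    (trans (lookup∘tabulate (lookup S ∘ combine {a} {m} g) c) ([]=⇒lookup gc∈))

∣S∣≡∑∣fibre∣ : ∀ a {m} (S : Subset (a * m)) → ∣ S ∣ ≡ ∑[ g < a ] ∣ fibre S g ∣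
∣S∣≡∑∣fibre∣ a {m} S = begin
  ∣ S ∣                                          ≡⟨ ∣p∣≡∑indicator S ⟩
  sum (indicator S)                              ≡⟨ ∑-combine a (indicator S) ⟩
  ∑[ g < a ] ∑[ c < m ] indicator S (combine g c) ≡⟨ sum-cong-≗ {a} (≡.sym ∘ fibre-size) ⟩
  ∑[ g < a ] ∣ fibre S g ∣                        ∎
  where
  fibre-size : ∀ g → ∣ fibre S g ∣ ≡ ∑[ c < m ] indicator S (combine g c)
  fibre-size g = trans (∣p∣≡∑indicator (fibre S g))
    (sum-cong-≗ {m} (λ c → cong (if_then 1 else 0) (lookup∘tabulate (lookup S ∘ combine g) c)))

×K-adj⁺ : ∀ G m {g g' c c'} → Adj G g g' → c ≢ c' → Adj (G ×ᵍ K m) (combine g c) (combine g' c')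
×K-adj⁺ G m {g} {g'} {c} {c'} a c≢c' =
  subst₂ (λ x y → Adj G (proj₁ x) (proj₁ y) × proj₂ x ≢ proj₂ y)
         (≡.sym (remQuot-combine g c)) (≡.sym (remQuot-combine g' c')) (a , c≢c')

×K-adj⁻ : ∀ G m {g c w} → Adj (G ×ᵍ K m) (combine g c) w →
          let (g' , c') = remQuot {order G} m w in Adj G g g' × c ≢ c'
×K-adj⁻ G m {g} {c} {w} =
  subst (λ x → Adj G (proj₁ x) (proj₁ w') × proj₂ x ≢ proj₂ w') (remQuot-combine g c)
  where
  w' : Fin (order G) × Fin m
  w' = remQuot {order G} m w

record MaximalFibres {V : Set} (A : V → V → Set) (m : ℕ) (Φ : V → Subset m) : Set where
  field
    agree     : ∀ {v w c d} → A v w → c ∈ Φ v → d ∈ Φ w → c ≡ d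
    saturated : ∀ {v c} → (∀ {w d} → A v w → d ∈ Φ w → d ≡ c) → c ∈ Φ v

fibres-maximal : ∀ G m {S} → MaximalIndependent (G ×ᵍ K m) S → MaximalFibres (Adj G) m (fibre S)
fibres-maximal G m {S} maxS@(independent , _) = record { agree = agree ; saturated = saturated }
  where
  agree : ∀ {g g' c c'} → Adj G g g' → c ∈ fibre S g → c' ∈ fibre S g' → c ≡ c'
  agree {c = c} {c'} a c∈ c'∈ with c ≟ c'
  ... | yes c≡c' = c≡c'
  ... | no  c≢c' = ⊥-elim (independent _ _ (∈-fibre⁻ {order G} c∈) (∈-fibre⁻ {order G} c'∈)
                                      (×K-adj⁺ G m a c≢c'))

  saturated : ∀ {g c} → (∀ {g' c'} → Adj G g g' → c' ∈ fibre S g' → c' ≡ c) → c ∈ fibre S g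
  saturated {g} {c} only-c = ∈-fibre⁺ {order G} (maximal-absorbs (G ×ᵍ K m) maxS unblocked)
    where
    unblocked : ∀ {w} → w ∈ S → ¬ Adj (G ×ᵍ K m) (combine g c) w
    unblocked {w} w∈S adj with ×K-adj⁻ G m adj
    ... | a , c≢c' = c≢c' (≡.sym (only-c a (∈-fibre⁺ {order G} w∈S')))
      where
      w∈S' : uncurry combine (remQuot {order G} m w) ∈ S
      w∈S' = subst (_∈ S) (≡.sym (combine-remQuot {order G} m w)) w∈S

MaximalFibres-reindex : ∀ {W V : Set} {R : W → W → Set} {A : V → V → Set} {m} {Φ : V → Subset m}
  (e : W → V) → (∀ v → ∃ λ x → e x ≡ v) → (∀ x y → R x y ⇔ A (e x) (e y)) →
  MaximalFibres A m Φ → MaximalFibres R m (Φ ∘ e)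
MaximalFibres-reindex {R = R} {A} {Φ = Φ} e surjective R⇔A maxΦ = record
  { agree     = λ {x} {y} r → agree (Equivalence.to (R⇔A x y) r)
  ; saturated = λ {x} only-c → saturated (λ {v} a → pulled-back x only-c (surjective v) a)
  }
  where
  open MaximalFibres maxΦ
  pulled-back : ∀ x {c d v} → (∀ {y d} → R x y → d ∈ Φ (e y) → d ≡ c) →
                (∃ λ y → e y ≡ v) → A (e x) v → d ∈ Φ v → d ≡ c
  pulled-back x only-c (y , refl) a = only-c (Equivalence.from (R⇔A x y) a)

module _ {V : Set} {A : V → V → Set} {m} {Φ : V → Subset m} (maxΦ : MaximalFibres A m Φ) where
  open MaximalFibres maxΦ

  neighbours-empty⇒full : ∀ {v} → (∀ {w} → A v w → Empty (Φ w)) → ∀ c → c ∈ Φ v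
  neighbours-empty⇒full empty c = saturated (λ a d∈ → ⊥-elim (empty a (_ , d∈)))

  two-colours⇒neighbours-empty : ∀ {v c c'} → c ≢ c' → c ∈ Φ v → c' ∈ Φ v →
                                 ∀ {w} → A v w → Empty (Φ w)
  two-colours⇒neighbours-empty c≢c' c∈ c'∈ a (d , d∈) =
    c≢c' (trans (agree a c∈ d∈) (≡.sym (agree a c'∈ d∈)))

H-adj : ∀ k n (x y : Fin k × Fin (suc n)) →
        HAdj x y ⇔ Adj (H k n) (uncurry combine x) (uncurry combine y)
H-adj k n (i , j) (i' , j') =
  subst₂ (λ x y → HAdj (i , j) (i' , j') ⇔ HAdj x y)
         (≡.sym (remQuot-combine i j)) (≡.sym (remQuot-combine i' j')) (mk⇔ id id)

module _ {k n} {Ψ : Fin k × Fin (suc n) → Subset (suc n)} (maxΨ : MaximalFibres HAdj (suc n) Ψ)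
         (i : Fin k) where
  open MaximalFibres maxΨ

  uncoloured-clique-block : (∀ a → Empty (Ψ (i , suc a))) → ∑[ j < suc n ] ∣ Ψ (i , j) ∣ ≡ suc n
  uncoloured-clique-block clique-empty =
    ∑∣∣-one-full (Ψ ∘ (i ,_)) zero (neighbours-empty⇒full maxΨ z-neighbours) others
    where
    z-neighbours : ∀ {w} → HAdj (i , zero) w → Empty (Ψ w)
    z-neighbours {_ , zero}  ()
    z-neighbours {_ , suc a} refl = clique-empty a
    others : ∀ j → j ≢ zero → Empty (Ψ (i , j))
    others zero    0≢0 = ⊥-elim (0≢0 refl)
    others (suc a) _   = clique-empty a

  two-coloured-block : ∀ a {c c'} → c ≢ c' → c ∈ Ψ (i , suc a) → c' ∈ Ψ (i , suc a) →
                       ∑[ j < suc n ] ∣ Ψ (i , j) ∣ ≡ suc n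
  two-coloured-block a c≢c' c∈ c'∈ =
    ∑∣∣-one-full (Ψ ∘ (i ,_)) (suc a) (neighbours-empty⇒full maxΨ empty) others
    where
    empty : ∀ {w} → HAdj (i , suc a) w → Empty (Ψ w)
    empty = two-colours⇒neighbours-empty maxΨ c≢c' c∈ c'∈
    others : ∀ j → j ≢ suc a → Empty (Ψ (i , j))
    others zero    _   = empty refl
    others (suc b) b≢a = empty (λ ia≡ib → b≢a (cong (suc ∘ proj₂) (≡.sym ia≡ib)))

  monochrome-block : ∀ a {c} → c ∈ Ψ (i , suc a) → (∀ {d} → d ∈ Ψ (i , suc a) → d ≡ c) →
                     ∑[ j < suc n ] ∣ Ψ (i , j) ∣ ≡ suc n
  monochrome-block a {c} c∈ only-c =
    ∑∣∣-singletons (Ψ ∘ (i ,_)) c (λ j → saturated (neighbours-only-c j)) block-only-c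
    where
    clique-only-c : ∀ i' b {d} → d ∈ Ψ (i' , suc b) → d ≡ c
    clique-only-c i' b d∈ with ≡-dec _≟_ _≟_ (i' , b) (i , a)
    ... | yes refl = only-c d∈
    ... | no  i'b≢ia = agree i'b≢ia d∈ c∈
    block-only-c : ∀ j {d} → d ∈ Ψ (i , j) → d ≡ c
    block-only-c zero    d∈ = agree refl d∈ c∈
    block-only-c (suc b)    = clique-only-c i b
    neighbours-only-c : ∀ j {w d} → HAdj (i , j) w → d ∈ Ψ w → d ≡ c
    neighbours-only-c zero    {_ , zero}   ()
    neighbours-only-c (suc _) {_ , zero}   refl = block-only-c zero
    neighbours-only-c _       {i' , suc b} _    = clique-only-c i' b

  block-size : ∑[ j < suc n ] ∣ Ψ (i , j) ∣ ≡ suc n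
  block-size with any? (λ a → nonempty? (Ψ (i , suc a)))
  ... | no no-colour = uncoloured-clique-block (λ a (c , c∈) → no-colour (a , c , c∈))
  ... | yes (a , c , c∈) with any? (λ d → ¬? (d ≟ c) ×-dec d ∈? Ψ (i , suc a))
  ...   | yes (d , d≢c , d∈) = two-coloured-block a d≢c d∈ c∈
  ...   | no  no-other       = monochrome-block a c∈ only-c
    where
    only-c : ∀ {d} → d ∈ Ψ (i , suc a) → d ≡ c
    only-c {d} d∈ with d ≟ c
    ... | yes d≡c = d≡c
    ... | no  d≢c = ⊥-elim (no-other (d , d≢c , d∈))

maximalIndependent-size : ∀ n k {S} → MaximalIndependent (H k n ×ᵍ K (suc n)) S → ∣ S ∣ ≡ k * suc n
maximalIndependent-size n k {S} maxS = begin
  ∣ S ∣                                               ≡⟨ ∣S∣≡∑∣fibre∣ (k * suc n) S ⟩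
  ∑[ g < k * suc n ] ∣ fibre S g ∣                    ≡⟨ ∑-combine k (∣_∣ ∘ fibre S) ⟩
  ∑[ i < k ] ∑[ j < suc n ] ∣ fibre S (combine i j) ∣ ≡⟨ sum-cong-≗ {k} (block-size maxΨ) ⟩
  ∑[ i < k ] suc n                                    ≡⟨ ∑-const k (suc n) ⟩
  k * suc n                                           ∎
  where
  maxΨ : MaximalFibres HAdj (suc n) (fibre S ∘ uncurry combine)
  maxΨ = MaximalFibres-reindex (uncurry combine)
           (λ v → remQuot {k} (suc n) v , combine-remQuot {k} (suc n) v)
           (H-adj k n) (fibres-maximal (H k n) (suc n) maxS)

proposition4p6 : ∀ (n k : ℕ) → n ≥ 1 → k ≥ 1 → WellCovered (H k n ×ᵍ K (suc n))
proposition4p6 n k _ _ S T maxS maxT =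
  trans (maximalIndependent-size n k maxS) (≡.sym (maximalIndependent-size n k maxT))
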